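{- Let $v$ be a positive even integer such that a periodic Golay pair of length $v$ exists, and suppose $v/2$ is odd. Let $(a,b)$ be integers with $a^2+b^2=2v$. Then the pair $([0,a],[0,b])$ is not the $(v/2)$-compression of any periodic Golay pair of length $v$ (that is, there is no periodic Golay pair $(A,B)$ of length $v$ with $A^{(v/2)}=[0,a]$ and $B^{(v/2)}=[0,b]$).
   Context: A periodic Golay pair of length $v$ is a pair of sequences $A=[a_0,\dots,a_{v-1}]$, $B=[b_0,\dots,b_{v-1}]$ with all entries in $\{ -1,+1\}$ such that $\mathrm{PAF}(A,s)+\mathrm{PAF}(B,s)=0$ for $s=1,\dots,v/2$, where $\mathrm{PAF}(A,s)=\sum_{k=0}^{v-1}a_ka_{k+s}$ with indices modulo $v$. For a positive divisor $m$ of $v$, the $m$-compression of $A$ is the length-$v/m$ sequence $A^{(m)}$ with entries $a^{(m)}_k=\sum_{j=0}^{m-1}a_{k+j\,v/m}$, $k=0,\dots,v/m-1$; the $m$-compression of a pair $(A,B)$ is $(A^{(m)},B^{(m)})$. -}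

module Defs where

open import Data.Nat as ℕ using (ℕ; zero; suc; NonZero; _≤_)
open import Data.Nat.DivMod using (_%_; _/_; m%n<n)
open import Data.Fin using (Fin; toℕ; fromℕ<)
open import Data.Product using (_×_)
open import Data.Integer as ℤ using (ℤ; +_; -[1+_])
open import Data.Sum using (_⊎_)
open import Relation.Binary.PropositionalEquality using (_≡_)

Seq : ℕ → Set
Seq v = Fin v → ℤ

sumFin : (n : ℕ) → (Fin n → ℤ) → ℤ
sumFin zero    f = + 0
sumFin (suc n) f = f Fin.zero ℤ.+ sumFin n (λ k → f (Fin.suc k))

modIdx : (v : ℕ) .{{_ : NonZero v}} → ℕ → Fin v
modIdx v i = fromℕ< (m%n<n i v)

IsPM1 : ∀ {v} → Seq v → Set
IsPM1 {v} A = ∀ (k : Fin v) → (A k ≡ + 1) ⊎ (A k ≡ -[1+ 0 ])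

PAF : (v : ℕ) .{{_ : NonZero v}} → Seq v → ℕ → ℤ
PAF v A s = sumFin v (λ k → A k ℤ.* A (modIdx v (toℕ k ℕ.+ s)))

IsPeriodicGolayPair : (v : ℕ) .{{_ : NonZero v}} → Seq v → Seq v → Set
IsPeriodicGolayPair v A B =
  IsPM1 A × IsPM1 B ×
  (∀ (s : ℕ) → 1 ≤ s → s ≤ v / 2 → PAF v A s ℤ.+ PAF v B s ≡ + 0)

-- m-compression of A (m a positive divisor of v): the length-(v/m) sequence
-- a^(m)_k = Σ_{j=0}^{m-1} a_{k + j·(v/m)}   (index taken mod v; it is < v anyway)
compress : (v m : ℕ) .{{_ : NonZero v}} .{{_ : NonZero m}} → Seq v → Seq (v / m)
compress v m A k = sumFin m (λ j → A (modIdx v (toℕ k ℕ.+ toℕ j ℕ.* (v / m))))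

pair2 : ℤ → ℤ → ℕ → ℤ
pair2 x y zero    = x
pair2 x y (suc _) = y

{-# OPTIONS --safe #-}
module Submission where

-- Every entry of an m-compression of a ±1 sequence is a sum of m signs, so it
-- has the parity of m.  For m = v/2 odd the entry 0 of [0, a] is therefore
-- impossible.

open import Defs
open import Data.Nat as ℕ using (ℕ; NonZero; zero; suc)
open import Data.Nat.Divisibility using (_∣_; divides)
open import Data.Nat.DivMod using (_/_; m≥n⇒m/n>0; m/n≤m)
open import Data.Integer as ℤ using (ℤ; +_; -[1+_])
import Data.Integer.Properties as ℤP
import Data.Nat.Properties as ℕP
open import Data.Integer.Tactic.RingSolver using (solve-∀)
open import Data.Fin using (Fin; toℕ; fromℕ<)
open import Data.Fin.Properties using (toℕ-fromℕ<)
open import Data.Product using (Σ; ∃-syntax; _×_; _,_; proj₁)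
open import Data.Sum using (inj₁; inj₂)
open import Relation.Nullary using (¬_)
open import Relation.Binary.PropositionalEquality
open ≡-Reasoning

-- c counts the entries equal to -1.
sumFin-pm1-parity : ∀ n (f : Seq n) → IsPM1 f →
  ∃[ c ] sumFin n f ℤ.+ + (2 ℕ.* c) ≡ + n
sumFin-pm1-parity zero f _ = 0 , refl
sumFin-pm1-parity (suc n) f f-pm1
  with sumFin-pm1-parity n (λ k → f (Fin.suc k)) (λ k → f-pm1 (Fin.suc k))
     | f Fin.zero | f-pm1 Fin.zero
... | c , ih | _ | inj₁ refl = c , (begin
  (+ 1 ℤ.+ S) ℤ.+ + (2 ℕ.* c)   ≡⟨ ℤP.+-assoc (+ 1) S _ ⟩
  + 1 ℤ.+ (S ℤ.+ + (2 ℕ.* c))   ≡⟨ cong (ℤ._+_ (+ 1)) ih ⟩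
  + suc n                        ∎)
  where S = sumFin n (λ k → f (Fin.suc k))
... | c , ih | _ | inj₂ refl = suc c , (begin
  (-[1+ 0 ] ℤ.+ S) ℤ.+ + (2 ℕ.* suc c)      ≡⟨ cong (λ x → (-[1+ 0 ] ℤ.+ S) ℤ.+ + x) (ℕP.*-suc 2 c) ⟩
  (-[1+ 0 ] ℤ.+ S) ℤ.+ + (2 ℕ.+ 2 ℕ.* c)    ≡⟨ cong (ℤ._+_ (-[1+ 0 ] ℤ.+ S)) (ℤP.pos-+ 2 (2 ℕ.* c)) ⟩
  (-[1+ 0 ] ℤ.+ S) ℤ.+ (+ 2 ℤ.+ + (2 ℕ.* c)) ≡⟨ regroup S (+ (2 ℕ.* c)) ⟩
  + 1 ℤ.+ (S ℤ.+ + (2 ℕ.* c))                ≡⟨ cong (ℤ._+_ (+ 1)) ih ⟩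
  + suc n                                     ∎)
  where
  S = sumFin n (λ k → f (Fin.suc k))
  regroup : ∀ S C → (-[1+ 0 ] ℤ.+ S) ℤ.+ (+ 2 ℤ.+ C) ≡ + 1 ℤ.+ (S ℤ.+ C)
  regroup = solve-∀

sumFin-pm1≡0⇒even : ∀ n (f : Seq n) → IsPM1 f → sumFin n f ≡ + 0 → 2 ∣ n
sumFin-pm1≡0⇒even n f f-pm1 sum≡0 with sumFin-pm1-parity n f f-pm1
... | c , parity = divides c (trans (ℤP.+-injective n≡2c) (ℕP.*-comm 2 c))
  where
  n≡2c : + n ≡ + (2 ℕ.* c)
  n≡2c = begin
    + n                            ≡⟨ parity ⟨
    sumFin n f ℤ.+ + (2 ℕ.* c)     ≡⟨ cong (λ s → s ℤ.+ + (2 ℕ.* c)) sum≡0 ⟩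
    + 0 ℤ.+ + (2 ℕ.* c)            ≡⟨ ℤP.+-identityˡ _ ⟩
    + (2 ℕ.* c)                    ∎

compress-pm1≡0⇒even : ∀ v m .{{_ : NonZero v}} .{{_ : NonZero m}} {A : Seq v} → IsPM1 A →
  (k : Fin (v / m)) → compress v m A k ≡ + 0 → 2 ∣ m
compress-pm1≡0⇒even v m A-pm1 k =
  sumFin-pm1≡0⇒even m _ (λ j → A-pm1 (modIdx v (toℕ k ℕ.+ toℕ j ℕ.* (v / m))))

mainTheorem3 : (v : ℕ) .{{_ : NonZero v}} .{{_ : NonZero (v / 2)}} →
  2 ∣ v → ¬ (2 ∣ (v / 2)) →
  (Σ (Seq v) λ A → Σ (Seq v) λ B → IsPeriodicGolayPair v A B) →
  (a b : ℤ) → a ℤ.* a ℤ.+ b ℤ.* b ≡ + (2 ℕ.* v) →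
  ¬ (Σ (Seq v) λ A → Σ (Seq v) λ B → IsPeriodicGolayPair v A B ×
       (∀ (k : Fin (v / (v / 2))) →
          compress v (v / 2) A k ≡ pair2 (+ 0) a (toℕ k) ×
          compress v (v / 2) B k ≡ pair2 (+ 0) b (toℕ k)))
mainTheorem3 v _ v/2-odd _ a _ _ (A , _ , (A-pm1 , _) , compress≡pair) =
  v/2-odd (compress-pm1≡0⇒even v (v / 2) A-pm1 first first-entry≡0)
  where
  0<length : 0 ℕ.< v / (v / 2)
  0<length = m≥n⇒m/n>0 (m/n≤m v 2)

  first : Fin (v / (v / 2))
  first = fromℕ< 0<length

  first-entry≡0 : compress v (v / 2) A first ≡ + 0
  first-entry≡0 = trans (proj₁ (compress≡pair first)) (cong (pair2 (+ 0) a) (toℕ-fromℕ< 0<length))
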